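{- Let $p,q\in\mathbb N$ with $p>q\ge1$ and let $\varphi$ be the morphism on $\{0,1\}^*$ with $\varphi(0)=0^p1$, $\varphi(1)=0^q1$. Then: (1) $\varphi^{n+1}(0)=(\varphi^n(0))^p\varphi^n(1)$ for all $n\in\mathbb N$; (2) $\varphi^k(1)$ is a suffix of $\varphi^k(0)$ for each $k\ge1$; (3) $\varphi^k(0)\varphi^{k-1}(0)\cdots\varphi(0)\varphi^0(0)$ is a prefix of $\varphi^{k+1}(0)$ for each $k\in\mathbb N$; (4) $\varphi^0(1)\varphi(1)\cdots\varphi^{k-1}(1)\varphi^k(1)$ is a suffix of $\varphi^{k+1}(0)$ for each $k\in\mathbb N$; (5) $\varphi^k(0)\varphi^{k-1}(0)\cdots\varphi(0)\varphi^0(0)$ is a prefix of $\varphi^{k+1}(1)$ for each $k\in\mathbb N$; (6) $\varphi(1)\varphi^2(1)\cdots\varphi^k(1)$ is a suffix of $\varphi^k(0)$ for each $k\ge1$; (7) $\varphi(1)\varphi^2(1)\cdots\varphi^k(1)\varphi^k(0)\cdots\varphi^2(0)\varphi(0)$ is a factor of $\varphi^{k+1}(0)$ for each $k\ge1$.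
   Context: $\varphi^0$ is the identity, so $\varphi^0(0)=0$ and $\varphi^0(1)=1$. A factor of a word $w$ is a word $y$ with $w=xyz$. -}

module Defs where

open import Data.Nat using (ℕ; zero; suc)
open import Data.List using (List; []; _∷_; _++_; concatMap; concat; replicate)
open import Data.Product using (∃; ∃-syntax)
open import Relation.Binary.PropositionalEquality using (_≡_)

data Bit : Set where
  𝟘 𝟙 : Bit

Word : Set
Word = List Bit

zeros : ℕ → Word
zeros n = replicate n 𝟘

_^ʷ_ : Word → ℕ → Word
w ^ʷ n = concat (replicate n w)

φ : ℕ → ℕ → Bit → Word
φ p q 𝟘 = zeros p ++ (𝟙 ∷ [])
φ p q 𝟙 = zeros q ++ (𝟙 ∷ [])

φ* : ℕ → ℕ → Word → Word
φ* p q w = concatMap (φ p q) w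

φ^ : ℕ → ℕ → ℕ → Word → Word
φ^ p q zero w = w
φ^ p q (suc n) w = φ* p q (φ^ p q n w)

_IsPrefixOf_ : Word → Word → Set
u IsPrefixOf w = ∃[ z ] (u ++ z ≡ w)

_IsSuffixOf_ : Word → Word → Set
u IsSuffixOf w = ∃[ x ] (x ++ u ≡ w)

_IsFactorOf_ : Word → Word → Set
u IsFactorOf w = ∃[ x ] ∃[ z ] (x ++ u ++ z ≡ w)

desc₀ : ℕ → ℕ → ℕ → Bit → Word
desc₀ p q zero a = φ^ p q zero (a ∷ [])
desc₀ p q (suc k) a = φ^ p q (suc k) (a ∷ []) ++ desc₀ p q k a

desc₁ : ℕ → ℕ → ℕ → Bit → Word
desc₁ p q zero a = []
desc₁ p q (suc k) a = φ^ p q (suc k) (a ∷ []) ++ desc₁ p q k a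

asc₀ : ℕ → ℕ → ℕ → Bit → Word
asc₀ p q zero a = φ^ p q zero (a ∷ [])
asc₀ p q (suc k) a = asc₀ p q k a ++ φ^ p q (suc k) (a ∷ [])

asc₁ : ℕ → ℕ → ℕ → Bit → Word
asc₁ p q zero a = []
asc₁ p q (suc k) a = asc₁ p q k a ++ φ^ p q (suc k) (a ∷ [])

{-# OPTIONS --safe #-}
-- Write Aₙ = φⁿ(0) and Bₙ = φⁿ(1). Since φⁿ⁺¹(a) = φⁿ(φ(a)) and φⁿ is a monoid
-- morphism, Aₙ₊₁ = Aₙ^p Bₙ and Bₙ₊₁ = Aₙ^q Bₙ, hence Aₙ₊₁ = Aₙ^(p−q) Bₙ₊₁. The descending product
-- φᵏ(0)⋯φ⁰(0) is a prefix of Aₖ^m Bₖ for every m ≥ 1; the induction needs this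
-- strengthening because Aₖ₊₁ and Bₖ₊₁ both have that shape. An ascending product
-- that is a suffix of Aₙ extends by Bₙ₊₁ to a suffix of Aₙ^m Bₙ₊₁ for m ≥ 1.
-- Finally, (7) is read off Aₖ₊₁ = Aₖ · Aₖ^(p−1) Bₖ: a suffix of the first Aₖ
-- meets a prefix of the rest.
module Submission where

open import Defs
open import Data.Nat using (ℕ; zero; suc; _+_; _∸_; _<_; _≤_; z≤n; s≤s)
open import Data.Nat.Properties using (m∸n+n≡m; m<n⇒0<n∸m; <⇒≤; ≤-trans)
open import Data.List using ([]; _∷_; _++_)
open import Data.List.Properties using (++-assoc; ++-identityʳ; concatMap-++)
open import Data.Product using (_×_; _,_)
open import Relation.Binary.PropositionalEquality
  using (_≡_; refl; sym; trans; cong; module ≡-Reasoning)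
open ≡-Reasoning

private
  variable
    u v w w′ : Word

^ʷ-+ : (w : Word) (m n : ℕ) → w ^ʷ (m + n) ≡ w ^ʷ m ++ w ^ʷ n
^ʷ-+ w zero    n = refl
^ʷ-+ w (suc m) n = trans (cong (w ++_) (^ʷ-+ w m n)) (sym (++-assoc w (w ^ʷ m) (w ^ʷ n)))

^ʷ-sucʳ : (w : Word) (m : ℕ) → w ^ʷ suc m ≡ w ^ʷ m ++ w
^ʷ-sucʳ w zero    = ++-identityʳ w
^ʷ-sucʳ w (suc m) = trans (cong (w ++_) (^ʷ-sucʳ w m)) (sym (++-assoc w (w ^ʷ m) w))

IsPrefixOf-respʳ-≡ : v ≡ w → u IsPrefixOf v → u IsPrefixOf w
IsPrefixOf-respʳ-≡ refl h = h

IsSuffixOf-respʳ-≡ : v ≡ w → u IsSuffixOf v → u IsSuffixOf w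
IsSuffixOf-respʳ-≡ refl h = h

IsFactorOf-respʳ-≡ : v ≡ w → u IsFactorOf v → u IsFactorOf w
IsFactorOf-respʳ-≡ refl h = h

IsPrefixOf-trans : u IsPrefixOf v → v IsPrefixOf w → u IsPrefixOf w
IsPrefixOf-trans {u} (y , refl) (z , refl) = y ++ z , sym (++-assoc u y z)

++-IsPrefixOf : u IsPrefixOf v → (w ++ u) IsPrefixOf (w ++ v)
++-IsPrefixOf {u} {w = w} (z , refl) = z , ++-assoc w u z

IsPrefixOf-^ʷ-++ : u IsPrefixOf w → u IsPrefixOf v → (m : ℕ) → u IsPrefixOf (w ^ʷ m ++ v)
IsPrefixOf-^ʷ-++ _ u⊑v zero = u⊑v
IsPrefixOf-^ʷ-++ {w = w} {v} u⊑w _ (suc m) =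
  IsPrefixOf-trans u⊑w (w ^ʷ m ++ v , sym (++-assoc w (w ^ʷ m) v))

IsSuffixOf-^ʷ-++ : ∀ {m} → u IsSuffixOf w → 1 ≤ m → (u ++ v) IsSuffixOf (w ^ʷ m ++ v)
IsSuffixOf-^ʷ-++ {u} {v = v} {m = suc m} (x , refl) _ = W ++ x , (begin
  (W ++ x) ++ u ++ v   ≡⟨ ++-assoc W x (u ++ v) ⟩
  W ++ x ++ u ++ v     ≡⟨ cong (W ++_) (++-assoc x u v) ⟨
  W ++ (x ++ u) ++ v   ≡⟨ ++-assoc W (x ++ u) v ⟨
  (W ++ x ++ u) ++ v   ≡⟨ cong (_++ v) (^ʷ-sucʳ (x ++ u) m) ⟨
  (x ++ u) ^ʷ suc m ++ v ∎)
  where W = (x ++ u) ^ʷ m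

IsSuffixOf-++-IsPrefixOf : u IsSuffixOf w → v IsPrefixOf w′ → (u ++ v) IsFactorOf (w ++ w′)
IsSuffixOf-++-IsPrefixOf {u} {v = v} (x , refl) (z , refl) = x , z , (begin
  x ++ (u ++ v) ++ z   ≡⟨ cong (x ++_) (++-assoc u v z) ⟩
  x ++ u ++ v ++ z     ≡⟨ ++-assoc x u (v ++ z) ⟨
  (x ++ u) ++ v ++ z   ∎)

module Iterates (p q : ℕ) where

  A B : ℕ → Word
  A n = φ^ p q n (𝟘 ∷ [])
  B n = φ^ p q n (𝟙 ∷ [])

  φ^-[] : (n : ℕ) → φ^ p q n [] ≡ []
  φ^-[] zero    = refl
  φ^-[] (suc n) = cong (φ* p q) (φ^-[] n)

  φ^-++ : (n : ℕ) (u v : Word) → φ^ p q n (u ++ v) ≡ φ^ p q n u ++ φ^ p q n v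
  φ^-++ zero    u v = refl
  φ^-++ (suc n) u v =
    trans (cong (φ* p q) (φ^-++ n u v)) (concatMap-++ (φ p q) (φ^ p q n u) (φ^ p q n v))

  φ^-φ* : (n : ℕ) (w : Word) → φ^ p q n (φ* p q w) ≡ φ^ p q (suc n) w
  φ^-φ* zero    w = refl
  φ^-φ* (suc n) w = cong (φ* p q) (φ^-φ* n w)

  φ^-suc-letter : (n : ℕ) (a : Bit) → φ^ p q (suc n) (a ∷ []) ≡ φ^ p q n (φ p q a)
  φ^-suc-letter n a = trans (sym (φ^-φ* n (a ∷ []))) (cong (φ^ p q n) (++-identityʳ (φ p q a)))

  φ^-zeros : (n m : ℕ) → φ^ p q n (zeros m) ≡ A n ^ʷ m
  φ^-zeros n zero    = φ^-[] n
  φ^-zeros n (suc m) = trans (φ^-++ n (𝟘 ∷ []) (zeros m)) (cong (A n ++_) (φ^-zeros n m))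

  φ^-zeros-𝟙 : (n m : ℕ) → φ^ p q n (zeros m ++ 𝟙 ∷ []) ≡ A n ^ʷ m ++ B n
  φ^-zeros-𝟙 n m = trans (φ^-++ n (zeros m) (𝟙 ∷ [])) (cong (_++ B n) (φ^-zeros n m))

  A-suc : (n : ℕ) → A (suc n) ≡ A n ^ʷ p ++ B n
  A-suc n = trans (φ^-suc-letter n 𝟘) (φ^-zeros-𝟙 n p)

  B-suc : (n : ℕ) → B (suc n) ≡ A n ^ʷ q ++ B n
  B-suc n = trans (φ^-suc-letter n 𝟙) (φ^-zeros-𝟙 n q)

  A-suc-via-B-suc : q ≤ p → (n : ℕ) → A (suc n) ≡ A n ^ʷ (p ∸ q) ++ B (suc n)
  A-suc-via-B-suc q≤p n = begin
    A (suc n)                               ≡⟨ A-suc n ⟩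
    A n ^ʷ p ++ B n                         ≡⟨ cong (λ e → A n ^ʷ e ++ B n) (m∸n+n≡m q≤p) ⟨
    A n ^ʷ (p ∸ q + q) ++ B n               ≡⟨ cong (_++ B n) (^ʷ-+ (A n) (p ∸ q) q) ⟩
    (A n ^ʷ (p ∸ q) ++ A n ^ʷ q) ++ B n     ≡⟨ ++-assoc (A n ^ʷ (p ∸ q)) (A n ^ʷ q) (B n) ⟩
    A n ^ʷ (p ∸ q) ++ A n ^ʷ q ++ B n       ≡⟨ cong (A n ^ʷ (p ∸ q) ++_) (B-suc n) ⟨
    A n ^ʷ (p ∸ q) ++ B (suc n)             ∎

  B-IsSuffixOf-A : q ≤ p → (n : ℕ) → B (suc n) IsSuffixOf A (suc n)
  B-IsSuffixOf-A q≤p n = A n ^ʷ (p ∸ q) , sym (A-suc-via-B-suc q≤p n)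

  desc₀-IsPrefixOf : 1 ≤ p → 1 ≤ q → (k m : ℕ) → 1 ≤ m →
                     desc₀ p q k 𝟘 IsPrefixOf (A k ^ʷ m ++ B k)
  desc₀-IsPrefixOf-A : 1 ≤ p → 1 ≤ q → (k : ℕ) → desc₀ p q k 𝟘 IsPrefixOf A (suc k)
  desc₀-IsPrefixOf-B : 1 ≤ p → 1 ≤ q → (k : ℕ) → desc₀ p q k 𝟘 IsPrefixOf B (suc k)

  desc₀-IsPrefixOf _   _   zero    (suc m) _ = _ , refl
  desc₀-IsPrefixOf 1≤p 1≤q (suc k) (suc m) _ =
    IsPrefixOf-respʳ-≡ (sym (++-assoc (A (suc k)) _ (B (suc k))))
      (++-IsPrefixOf
        (IsPrefixOf-^ʷ-++ (desc₀-IsPrefixOf-A 1≤p 1≤q k) (desc₀-IsPrefixOf-B 1≤p 1≤q k) m))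

  desc₀-IsPrefixOf-A 1≤p 1≤q k =
    IsPrefixOf-respʳ-≡ (sym (A-suc k)) (desc₀-IsPrefixOf 1≤p 1≤q k p 1≤p)
  desc₀-IsPrefixOf-B 1≤p 1≤q k =
    IsPrefixOf-respʳ-≡ (sym (B-suc k)) (desc₀-IsPrefixOf 1≤p 1≤q k q 1≤q)

  desc₁-IsPrefixOf-desc₀ : (k : ℕ) (a : Bit) → desc₁ p q k a IsPrefixOf desc₀ p q k a
  desc₁-IsPrefixOf-desc₀ zero    a = a ∷ [] , refl
  desc₁-IsPrefixOf-desc₀ (suc k) a = ++-IsPrefixOf (desc₁-IsPrefixOf-desc₀ k a)

  asc₀-IsSuffixOf-A : 1 ≤ p → (k : ℕ) → asc₀ p q k 𝟙 IsSuffixOf A (suc k)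
  asc₀-IsSuffixOf-A _   zero    = zeros p , sym (++-identityʳ _)
  asc₀-IsSuffixOf-A 1≤p (suc k) =
    IsSuffixOf-respʳ-≡ (sym (A-suc (suc k)))
      (IsSuffixOf-^ʷ-++ (asc₀-IsSuffixOf-A 1≤p k) 1≤p)

  asc₁-IsSuffixOf-A : q < p → (k : ℕ) → asc₁ p q k 𝟙 IsSuffixOf A k
  asc₁-IsSuffixOf-A _   zero    = A zero , refl
  asc₁-IsSuffixOf-A q<p (suc k) =
    IsSuffixOf-respʳ-≡ (sym (A-suc-via-B-suc (<⇒≤ q<p) k))
      (IsSuffixOf-^ʷ-++ (asc₁-IsSuffixOf-A q<p k) (m<n⇒0<n∸m q<p))

  asc₁-++-desc₁-IsFactorOf-A : 1 ≤ q → q < p → (k : ℕ) →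
                               (asc₁ p q k 𝟙 ++ desc₁ p q k 𝟘) IsFactorOf A (suc k)
  asc₁-++-desc₁-IsFactorOf-A 1≤q q<p@(s≤s {n = p′} q≤p′) k =
    IsFactorOf-respʳ-≡ (sym (trans (A-suc k) (++-assoc (A k) (A k ^ʷ p′) (B k))))
      (IsSuffixOf-++-IsPrefixOf (asc₁-IsSuffixOf-A q<p k)
        (IsPrefixOf-trans (desc₁-IsPrefixOf-desc₀ k 𝟘)
          (desc₀-IsPrefixOf (s≤s z≤n) 1≤q k p′ (≤-trans 1≤q q≤p′))))

lemma5p5 : (p q : ℕ) → 1 ≤ q → q < p →
    ((n : ℕ) → φ^ p q (suc n) (𝟘 ∷ []) ≡ (φ^ p q n (𝟘 ∷ []) ^ʷ p) ++ φ^ p q n (𝟙 ∷ []))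
  × ((k : ℕ) → 1 ≤ k → φ^ p q k (𝟙 ∷ []) IsSuffixOf φ^ p q k (𝟘 ∷ []))
  × ((k : ℕ) → desc₀ p q k 𝟘 IsPrefixOf φ^ p q (suc k) (𝟘 ∷ []))
  × ((k : ℕ) → asc₀ p q k 𝟙 IsSuffixOf φ^ p q (suc k) (𝟘 ∷ []))
  × ((k : ℕ) → desc₀ p q k 𝟘 IsPrefixOf φ^ p q (suc k) (𝟙 ∷ []))
  × ((k : ℕ) → 1 ≤ k → asc₁ p q k 𝟙 IsSuffixOf φ^ p q k (𝟘 ∷ []))
  × ((k : ℕ) → 1 ≤ k → (asc₁ p q k 𝟙 ++ desc₁ p q k 𝟘) IsFactorOf φ^ p q (suc k) (𝟘 ∷ []))
lemma5p5 p q 1≤q q<p =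
    A-suc
  , (λ { (suc k) _ → B-IsSuffixOf-A q≤p k })
  , desc₀-IsPrefixOf-A 1≤p 1≤q
  , asc₀-IsSuffixOf-A 1≤p
  , desc₀-IsPrefixOf-B 1≤p 1≤q
  , (λ k _ → asc₁-IsSuffixOf-A q<p k)
  , (λ k _ → asc₁-++-desc₁-IsFactorOf-A 1≤q q<p k)
  where
  open Iterates p q
  q≤p : q ≤ p
  q≤p = <⇒≤ q<p
  1≤p : 1 ≤ p
  1≤p = ≤-trans 1≤q q≤p
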